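{- Let $a,b$ be indeterminates and let $k\ge2$ be an even integer. Then there is a sum-of-squares proof of degree $k$ (in $a,b$) of $$\sum_{i=0}^k a^ib^{k-i}\ge\tfrac12(a^k+b^k),$$ i.e. $\sum_{i=0}^k a^ib^{k-i}-\tfrac12(a^k+b^k)$ is a sum of squares of polynomials of degree at most $k/2$. -}

module Defs where

open import Data.Nat using (ℕ; _+_; _∸_; _≡ᵇ_; _≤_)
open import Data.Bool using (if_then_else_; _∧_)
open import Data.Rational using (ℚ; 0ℚ; 1ℚ; -½) renaming (_+_ to _+ℚ_; _*_ to _*ℚ_)
open import Data.Product using (_×_; _,_; Σ)
open import Data.List using (List; []; _∷_; _++_; map; concatMap; upTo; foldr)
open import Data.List.Relation.Unary.All using (All)
open import Relation.Binary.PropositionalEquality using (_≡_)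

-- A term (c , i , j) denotes the monomial  c · a^i · b^j  in the indeterminates a, b.
Term : Set
Term = ℚ × ℕ × ℕ

-- A polynomial in ℚ[a,b] is represented by a finite list of terms (their sum).
Poly : Set
Poly = List Term

_⊕_ : Poly → Poly → Poly
p ⊕ q = p ++ q

_⊗_ : Poly → Poly → Poly
p ⊗ q = concatMap (λ { (c , i , j) → map (λ { (d , m , n) → (c *ℚ d , i + m , j + n) }) q }) p

coeff : Poly → ℕ → ℕ → ℚ
coeff [] i j = 0ℚ
coeff ((c , i' , j') ∷ p) i j = (if (i' ≡ᵇ i) ∧ (j' ≡ᵇ j) then c else 0ℚ) +ℚ coeff p i j

_≈P_ : Poly → Poly → Set
p ≈P q = ∀ i j → coeff p i j ≡ coeff q i j

DegLe : ℕ → Poly → Set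
DegLe d p = All (λ { (c , i , j) → i + j ≤ d }) p

sumSq : List Poly → Poly
sumSq = foldr (λ q acc → (q ⊗ q) ⊕ acc) []

IsSOSdeg : ℕ → Poly → Set
IsSOSdeg d p = Σ (List Poly) λ qs → All (DegLe d) qs × (p ≈P sumSq qs)

target : ℕ → Poly
target k = map (λ i → (1ℚ , i , k ∸ i)) (upTo (ℕ.suc k)) ⊕ ((-½ , k , 0) ∷ (-½ , 0 , k) ∷ [])

-- Write k = 2m and e(x, y) = ½ (aˣ bʸ⁺¹ + aˣ⁺¹ bʸ). Summing the k half-edges
-- e(t, k-1-t) along the antidiagonal gives Σ aⁱ bᵏ⁻ⁱ - ½ (aᵏ + bᵏ): every inner
-- monomial lies on two consecutive edges, the two end monomials on one only.
-- Since 2 e(x, y)² = e(2x, 2y+1) + e(2x+1, 2y), these half-edges pair up into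
-- the doubled squares 2 e(t, m-1-t)² = e(t, m-1-t)² + e(t, m-1-t)², t < m, of
-- polynomials of degree m.
module Submission where

open import Defs
open import Data.Nat using (ℕ; _≤_; _/_)
open import Data.Nat.Divisibility using (_∣_)

open import Data.Nat.Base using (zero; suc; _∸_; _≡ᵇ_; _*_)
  renaming (_+_ to _+ℕ_)
open import Data.Nat.Properties using (+-suc; *-comm; ≤-refl; ≤-reflexive)
  renaming (+-identityʳ to +ℕ-identityʳ)
open import Data.Nat.DivMod using (m*n/n≡m)
open import Data.Nat.Divisibility using (divides)
open import Data.Bool using (true; false; if_then_else_; _∧_)
open import Data.Rational using (ℚ; 0ℚ; 1ℚ; ½; -½; _+_)
open import Data.Rational.Properties using (+-assoc; +-comm; +-identityˡ; +-0-commutativeMonoid)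
open import Data.Product using (_,_)
open import Data.List using (List; []; _∷_; _++_; map; applyUpTo; upTo)
open import Data.List.Properties using (map-upTo)
open import Data.List.Relation.Unary.All using (All; []; _∷_)
open import Function using (_∘_)
open import Level using (0ℓ)
open import Relation.Binary.Bundles using (Setoid)
open import Relation.Binary.PropositionalEquality
open import Algebra.Bundles using (CommutativeMonoid)
open import Algebra.Properties.CommutativeSemigroup
  (CommutativeMonoid.commutativeSemigroup +-0-commutativeMonoid)
  using (x∙yz≈y∙xz; interchange)
import Relation.Binary.Reasoning.Setoid as SetoidReasoning

monomialCoeff : ℚ → ℕ → ℕ → ℕ → ℕ → ℚ
monomialCoeff c x y i j = if (x ≡ᵇ i) ∧ (y ≡ᵇ j) then c else 0ℚ

monomialCoeff-+ : ∀ c d x y i j →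
  monomialCoeff c x y i j + monomialCoeff d x y i j ≡ monomialCoeff (c + d) x y i j
monomialCoeff-+ c d x y i j with (x ≡ᵇ i) ∧ (y ≡ᵇ j)
... | true  = refl
... | false = refl

monomialCoeff-0 : ∀ x y i j → monomialCoeff 0ℚ x y i j ≡ 0ℚ
monomialCoeff-0 x y i j with (x ≡ᵇ i) ∧ (y ≡ᵇ j)
... | true  = refl
... | false = refl

coeff-++ : ∀ p q i j → coeff (p ++ q) i j ≡ coeff p i j + coeff q i j
coeff-++ [] q i j = sym (+-identityˡ _)
coeff-++ ((c , x , y) ∷ p) q i j =
  trans (cong (monomialCoeff c x y i j +_) (coeff-++ p q i j))
        (sym (+-assoc (monomialCoeff c x y i j) _ _))

infix 4 _≋_

-- Unlike the function type _≈P_ unfolds to, a record type is injective, so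
-- Agda can infer the polynomials compared by _≋_.
record _≋_ (p q : Poly) : Set where
  constructor coeffwise
  field same-coeff : p ≈P q
open _≋_

≋-setoid : Setoid 0ℓ 0ℓ
≋-setoid = record
  { Carrier       = Poly
  ; _≈_           = _≋_
  ; isEquivalence = record
    { refl  = coeffwise λ i j → refl
    ; sym   = λ p≋q → coeffwise λ i j → sym (same-coeff p≋q i j)
    ; trans = λ p≋q q≋r → coeffwise λ i j → trans (same-coeff p≋q i j) (same-coeff q≋r i j)
    }
  }

open Setoid ≋-setoid using () renaming (sym to ≋-sym; trans to ≋-trans)

∷-congʳ : ∀ t {p q} → p ≋ q → t ∷ p ≋ t ∷ q
∷-congʳ (c , x , y) p≋q = coeffwise λ i j → cong (monomialCoeff c x y i j +_) (same-coeff p≋q i j)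

++-congˡ : ∀ p {q r} → q ≋ r → p ++ q ≋ p ++ r
++-congˡ []      q≋r = q≋r
++-congˡ (t ∷ p) q≋r = ∷-congʳ t (++-congˡ p q≋r)

++-comm : ∀ p q → p ++ q ≋ q ++ p
++-comm p q = coeffwise λ i j → let open ≡-Reasoning in begin
  coeff (p ++ q) i j          ≡⟨ coeff-++ p q i j ⟩
  coeff p i j + coeff q i j   ≡⟨ +-comm (coeff p i j) _ ⟩
  coeff q i j + coeff p i j   ≡⟨ coeff-++ q p i j ⟨
  coeff (q ++ p) i j          ∎

∷-swap : ∀ t u p → t ∷ u ∷ p ≋ u ∷ t ∷ p
∷-swap (c , x , y) (d , x′ , y′) p = coeffwise λ i j →
  x∙yz≈y∙xz (monomialCoeff c x y i j) (monomialCoeff d x′ y′ i j) (coeff p i j)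

∷-merge : ∀ c d x y p → (c , x , y) ∷ (d , x , y) ∷ p ≋ (c + d , x , y) ∷ p
∷-merge c d x y p = coeffwise λ i j →
  trans (sym (+-assoc (monomialCoeff c x y i j) _ _))
        (cong (_+ coeff p i j) (monomialCoeff-+ c d x y i j))

∷-dropZero : ∀ x y p → (0ℚ , x , y) ∷ p ≋ p
∷-dropZero x y p = coeffwise λ i j →
  trans (cong (_+ coeff p i j) (monomialCoeff-0 x y i j)) (+-identityˡ _)

double : Term → Term
double (c , x , y) = (c + c , x , y)

coeff-map-double : ∀ q i j → coeff (map double q) i j ≡ coeff q i j + coeff q i j
coeff-map-double [] i j = refl
coeff-map-double ((c , x , y) ∷ q) i j = begin
  monomialCoeff (c + c) x y i j + coeff (map double q) i j
    ≡⟨ cong₂ _+_ (sym (monomialCoeff-+ c c x y i j)) (coeff-map-double q i j) ⟩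
  (cxy + cxy) + (coeff q i j + coeff q i j)
    ≡⟨ interchange cxy cxy (coeff q i j) (coeff q i j) ⟩
  (cxy + coeff q i j) + (cxy + coeff q i j)
    ∎
  where
  open ≡-Reasoning
  cxy = monomialCoeff c x y i j

++-self : ∀ q p → q ++ (q ++ p) ≋ map double q ++ p
++-self q p = coeffwise λ i j → let open ≡-Reasoning in begin
  coeff (q ++ (q ++ p)) i j                   ≡⟨ coeff-++ q (q ++ p) i j ⟩
  coeff q i j + coeff (q ++ p) i j            ≡⟨ cong (coeff q i j +_) (coeff-++ q p i j) ⟩
  coeff q i j + (coeff q i j + coeff p i j)   ≡⟨ +-assoc (coeff q i j) _ _ ⟨
  (coeff q i j + coeff q i j) + coeff p i j   ≡⟨ cong (_+ coeff p i j) (coeff-map-double q i j) ⟨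
  coeff (map double q) i j + coeff p i j      ≡⟨ coeff-++ (map double q) p i j ⟨
  coeff (map double q ++ p) i j               ∎

halfEdge : ℕ → ℕ → Poly
halfEdge x y = (½ , x , suc y) ∷ (½ , suc x , y) ∷ []

edgeSum : ℕ → ℕ → Poly
edgeSum x zero    = []
edgeSum x (suc y) = halfEdge x y ++ edgeSum (suc x) y

antidiagonal : ℕ → ℕ → Poly
antidiagonal x zero    = (1ℚ , x , 0) ∷ []
antidiagonal x (suc y) = (1ℚ , x , suc y) ∷ antidiagonal (suc x) y

halfEdgePairs : ℕ → ℕ → List Poly
halfEdgePairs x zero    = []
halfEdgePairs x (suc d) = halfEdge x d ∷ halfEdge x d ∷ halfEdgePairs (suc x) d

halfEdge-degree : ∀ x y → DegLe (x +ℕ suc y) (halfEdge x y)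
halfEdge-degree x y = ≤-refl ∷ ≤-reflexive (sym (+-suc x y)) ∷ []

halfEdgePairs-degree : ∀ x d → All (DegLe (x +ℕ d)) (halfEdgePairs x d)
halfEdgePairs-degree x zero    = []
halfEdgePairs-degree x (suc d) =
  halfEdge-degree x d ∷ halfEdge-degree x d ∷
  subst (λ n → All (DegLe n) (halfEdgePairs (suc x) d)) (sym (+-suc x d))
        (halfEdgePairs-degree (suc x) d)

-- 2 (halfEdge x y)² = halfEdge 2x (2y+1) + halfEdge (2x+1) 2y.
edgeSum-double-suc : ∀ x y →
  edgeSum (x +ℕ x) (suc y +ℕ suc y)
    ≡ map double (halfEdge x y ⊗ halfEdge x y) ++ edgeSum (suc x +ℕ suc x) (y +ℕ y)
edgeSum-double-suc x y rewrite +-suc x x | +-suc y y = refl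

sumSq-halfEdgePairs : ∀ x d → sumSq (halfEdgePairs x d) ≋ edgeSum (x +ℕ x) (d +ℕ d)
sumSq-halfEdgePairs x zero    = coeffwise λ i j → refl
sumSq-halfEdgePairs x (suc d) = begin
  (e ⊗ e) ++ ((e ⊗ e) ++ sumSq (halfEdgePairs (suc x) d))
    ≈⟨ ++-self (e ⊗ e) _ ⟩
  map double (e ⊗ e) ++ sumSq (halfEdgePairs (suc x) d)
    ≈⟨ ++-congˡ (map double (e ⊗ e)) (sumSq-halfEdgePairs (suc x) d) ⟩
  map double (e ⊗ e) ++ edgeSum (suc x +ℕ suc x) (d +ℕ d)
    ≡⟨ edgeSum-double-suc x d ⟨
  edgeSum (x +ℕ x) (suc d +ℕ suc d)
    ∎
  where
  open SetoidReasoning ≋-setoid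
  e = halfEdge x d

applyUpTo-antidiagonal : ∀ (f : ℕ → Term) x y → (∀ t → f t ≡ (1ℚ , x +ℕ t , y ∸ t)) →
  applyUpTo f (suc y) ≡ antidiagonal x y
applyUpTo-antidiagonal f x zero    f≗ =
  cong (_∷ []) (trans (f≗ 0) (cong (λ n → 1ℚ , n , 0) (+ℕ-identityʳ x)))
applyUpTo-antidiagonal f x (suc y) f≗ =
  cong₂ _∷_ (trans (f≗ 0) (cong (λ n → 1ℚ , n , suc y) (+ℕ-identityʳ x)))
            (applyUpTo-antidiagonal (f ∘ suc) (suc x) y
              (λ t → trans (f≗ (suc t)) (cong (λ n → 1ℚ , n , y ∸ t) (+-suc x t))))

antidiagonal≋edgeSum : ∀ x y → antidiagonal x y ≋ (½ , x , y) ∷ (½ , x +ℕ y , 0) ∷ edgeSum x y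
antidiagonal≋edgeSum x zero = begin
  (1ℚ , x , 0) ∷ []                    ≈⟨ ∷-merge ½ ½ x 0 [] ⟨
  (½ , x , 0) ∷ (½ , x , 0) ∷ []       ≡⟨ cong (λ n → (½ , x , 0) ∷ (½ , n , 0) ∷ []) (+ℕ-identityʳ x) ⟨
  (½ , x , 0) ∷ (½ , x +ℕ 0 , 0) ∷ []  ∎
  where open SetoidReasoning ≋-setoid
antidiagonal≋edgeSum x (suc y) = begin
  (1ℚ , x , suc y) ∷ antidiagonal (suc x) y
    ≈⟨ ∷-congʳ _ (antidiagonal≋edgeSum (suc x) y) ⟩
  (1ℚ , x , suc y) ∷ (½ , suc x , y) ∷ corner ∷ rest
    ≈⟨ ∷-merge ½ ½ x (suc y) _ ⟨
  (½ , x , suc y) ∷ (½ , x , suc y) ∷ (½ , suc x , y) ∷ corner ∷ rest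
    ≈⟨ ∷-congʳ _ (∷-congʳ _ (∷-swap _ _ _)) ⟩
  (½ , x , suc y) ∷ (½ , x , suc y) ∷ corner ∷ (½ , suc x , y) ∷ rest
    ≈⟨ ∷-congʳ _ (∷-swap _ _ _) ⟩
  (½ , x , suc y) ∷ corner ∷ (½ , x , suc y) ∷ (½ , suc x , y) ∷ rest
    ≡⟨ cong (λ n → (½ , x , suc y) ∷ (½ , n , 0) ∷ edgeSum x (suc y)) (+-suc x y) ⟨
  (½ , x , suc y) ∷ (½ , x +ℕ suc y , 0) ∷ edgeSum x (suc y)
    ∎
  where
  open SetoidReasoning ≋-setoid
  corner = (½ , suc x +ℕ y , 0)
  rest   = edgeSum (suc x) y

target≋edgeSum : ∀ k → target k ≋ edgeSum 0 k
target≋edgeSum k = begin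
  map (λ i → 1ℚ , i , k ∸ i) (upTo (suc k)) ++ ends
    ≡⟨ cong (_++ ends) (trans (map-upTo _ (suc k)) (applyUpTo-antidiagonal _ 0 k (λ _ → refl))) ⟩
  antidiagonal 0 k ++ ends
    ≈⟨ ++-comm (antidiagonal 0 k) ends ⟩
  (-½ , k , 0) ∷ (-½ , 0 , k) ∷ antidiagonal 0 k
    ≈⟨ ++-congˡ ends (antidiagonal≋edgeSum 0 k) ⟩
  (-½ , k , 0) ∷ (-½ , 0 , k) ∷ (½ , 0 , k) ∷ (½ , k , 0) ∷ edgeSum 0 k
    ≈⟨ ∷-congʳ _ (∷-merge -½ ½ 0 k _) ⟩
  (-½ , k , 0) ∷ (0ℚ , 0 , k) ∷ (½ , k , 0) ∷ edgeSum 0 k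
    ≈⟨ ∷-congʳ _ (∷-dropZero 0 k _) ⟩
  (-½ , k , 0) ∷ (½ , k , 0) ∷ edgeSum 0 k
    ≈⟨ ∷-merge -½ ½ k 0 _ ⟩
  (0ℚ , k , 0) ∷ edgeSum 0 k
    ≈⟨ ∷-dropZero k 0 _ ⟩
  edgeSum 0 k
    ∎
  where
  open SetoidReasoning ≋-setoid
  ends = (-½ , k , 0) ∷ (-½ , 0 , k) ∷ []

target-even-isSOS : ∀ m → IsSOSdeg m (target (m +ℕ m))
target-even-isSOS m =
  halfEdgePairs 0 m ,
  halfEdgePairs-degree 0 m ,
  same-coeff (≋-trans (target≋edgeSum (m +ℕ m)) (≋-sym (sumSq-halfEdgePairs 0 m)))

lemma4p50 : (k : ℕ) → 2 ≤ k → 2 ∣ k → IsSOSdeg (k / 2) (target k)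
lemma4p50 .(m * 2) _ (divides m refl) =
  subst₂ (λ d k → IsSOSdeg d (target k)) (sym (m*n/n≡m m 2)) m+m≡m*2 (target-even-isSOS m)
  where
  m+m≡m*2 : m +ℕ m ≡ m * 2
  m+m≡m*2 = trans (cong (m +ℕ_) (sym (+ℕ-identityʳ m))) (*-comm 2 m)
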